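{- A finite simple graph $G$ is a line multigraph (i.e. $G\cong L(G')$ for some loopless multigraph $G'$) if and only if the eLehot algorithm has an output on input $G$.
   Context: For a loopless multigraph $G'$, its line graph $L(G')$ has one vertex for each edge of $G'$, two vertices being adjacent iff the corresponding edges share an end vertex. Two distinct vertices of a simple graph are true twins if they are adjacent and have equal closed neighbourhoods; this relation (with equality) is an equivalence relation whose classes are cliques. The eLehot algorithm on input $G$: Step 1: contract every edge of $G$ whose end vertices are true twins, obtaining the simple graph $H$ whose vertices are the true-twin classes of $G$ (two classes adjacent iff their vertices are adjacent in $G$), each vertex of $H$ labelled by the size of its class. Step 2: run Lehot's algorithm on $H$, which outputs a simple graph $H'$ with $L(H')=H$ if such a simple graph exists and otherwise gives no output. Step 3: if $H'$ is output, replace each edge of $H'$ by as many parallel edges as the label of the corresponding vertex of $H$; the resulting multigraph is the output of eLehot. Otherwise eLehot has no output. -}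

module Defs where

open import Data.Nat using (ℕ; _<ᵇ_)
open import Data.Fin using (Fin; toℕ)
open import Data.Fin.Properties using (_≟_)
open import Data.Bool using (Bool; true; false; _∧_; _∨_; not; _xor_)
open import Data.List using (List; length; lookup; filterᵇ; concatMap; replicate; allFin)
open import Data.Bool.ListAction using (all; any)
open import Data.List.Relation.Unary.All using (All)
open import Data.Maybe using (Maybe; just; nothing)
import Data.Maybe as Maybe
open import Data.Product using (Σ; _×_; _,_; proj₁; proj₂)
open import Data.Sum using (_⊎_)
open import Relation.Nullary using (¬_; ⌊_⌋)
open import Relation.Binary.PropositionalEquality using (_≡_; _≢_)

record Graph : Set where
  field
    size : ℕ
    adj  : Fin size → Fin size → Bool

IsSimple : Graph → Set
IsSimple G = (∀ i j → adj i j ≡ adj j i) × (∀ i → adj i i ≡ false)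
  where open Graph G

record Iso (G H : Graph) : Set where
  field
    to       : Fin (Graph.size G) → Fin (Graph.size H)
    from     : Fin (Graph.size H) → Fin (Graph.size G)
    from-to  : ∀ i → from (to i) ≡ i
    to-from  : ∀ j → to (from j) ≡ j
    preserve : ∀ i j → Graph.adj H (to i) (to j) ≡ Graph.adj G i j

-- Multigraphs: vertex set Fin nv, a finite list of edges (pairs of end
-- vertices); parallel edges are repeated entries of the list.

record Multigraph : Set where
  field
    nv    : ℕ
    edges : List (Fin nv × Fin nv)

module _ (M : Multigraph) where
  open Multigraph M

  Edge : Set
  Edge = Fin (length edges)

  ends : Edge → Fin nv × Fin nv
  ends = lookup edges

  Loopless : Set
  Loopless = All (λ e → proj₁ e ≢ proj₂ e) edges

  SameEnds : Edge → Edge → Set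
  SameEnds k l = (proj₁ (ends k) ≡ proj₁ (ends l) × proj₂ (ends k) ≡ proj₂ (ends l))
               ⊎ (proj₁ (ends k) ≡ proj₂ (ends l) × proj₂ (ends k) ≡ proj₁ (ends l))

  IsSimpleMG : Set
  IsSimpleMG = Loopless × (∀ k l → SameEnds k l → k ≡ l)

feq : ∀ {n} → Fin n → Fin n → Bool
feq a b = ⌊ a ≟ b ⌋

L : Multigraph → Graph
L M = record
  { size = length (Multigraph.edges M)
  ; adj  = λ k l → not (feq k l) ∧ share (ends M k) (ends M l)
  }
  where
  share : _ → _ → Bool
  share (a , b) (c , d) = feq a c ∨ feq a d ∨ feq b c ∨ feq b d

IsLineMultigraph : Graph → Set
IsLineMultigraph G = Σ Multigraph λ G' → Loopless G' × Iso G (L G')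

-- Step 1: contraction of true twins.

beq : Bool → Bool → Bool
beq x y = not (x xor y)

module _ (G : Graph) where
  open Graph G

  inClosedNb : Fin size → Fin size → Bool
  inClosedNb i k = feq k i ∨ adj i k

  twinOrEq : Fin size → Fin size → Bool
  twinOrEq i j = feq i j ∨ (adj i j ∧ all (λ k → beq (inClosedNb i k) (inClosedNb j k)) (allFin size))

  -- representatives: least vertex (by index) of its true-twin class
  isRep : Fin size → Bool
  isRep i = not (any (λ j → (toℕ j <ᵇ toℕ i) ∧ twinOrEq j i) (allFin size))

  reps : List (Fin size)
  reps = filterᵇ isRep (allFin size)

  contract : Graph
  contract = record
    { size = length reps
    ; adj  = λ c d → adj (lookup reps c) (lookup reps d)
    }

  label : Fin (Graph.size contract) → ℕ
  label c = length (filterᵇ (twinOrEq (lookup reps c)) (allFin size))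

-- Step 2: Lehot's algorithm, specified by its input/output behaviour:
-- on input H it outputs a simple graph H' together with L(H') ≅ H,
-- and gives no output only if no such simple graph exists.

LehotOutput : Graph → Set
LehotOutput H = Σ Multigraph λ H' → IsSimpleMG H' × Iso (L H') H

LehotAlgorithm : Set
LehotAlgorithm = (H : Graph) → Maybe (LehotOutput H)

LehotSpec : LehotAlgorithm → Set
LehotSpec lehot = ∀ H → lehot H ≡ nothing → ¬ LehotOutput H

-- Step 3 and eLehot.

step3 : (G : Graph) → LehotOutput (contract G) → Multigraph
step3 G (H' , _ , iso) = record
  { nv    = Multigraph.nv H'
  ; edges = concatMap (λ k → replicate (label G (Iso.to iso k)) (ends H' k))
                      (allFin (length (Multigraph.edges H')))
  }

eLehot : LehotAlgorithm → Graph → Maybe Multigraph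
eLehot lehot G = Maybe.map (step3 G) (lehot (contract G))

module Submission where

-- Let G be simple and H = contract G its true-twin contraction.  By the
-- specification of Lehot's algorithm, eLehot has an output on G iff H ≅ L(H')
-- for some simple H'; so it suffices to show that this holds iff G is a line
-- multigraph.
--  (⇒) If G ≅ L(G'), parallel edges of G' are true twins of G, so the edges of
--      the class representatives form a simple H' with L(H') ≅ H.
--  (⇐) Step 3 copies each edge of H' once per member of its class.  Vertices of
--      G (mapped to their class) and copies (mapped to the copied edge) have
--      equal fibres over the edges of H', hence correspond bijectively; the
--      bijection preserves adjacency because twins are adjacent with the same
--      other neighbours, and distinct classes are adjacent as in H ≅ L(H').

open import Defs
open import Function using (_∘_; Equivalence)
open import Function.Definitions using (Injective)
open import Data.Nat using (ℕ; zero; suc; _+_; _<_; s≤s)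
open import Data.Nat.Properties using (+-cancelˡ-≡; +-identityʳ; <-cmp; <-≤-trans; n<1+n; <ᵇ⇒<; <⇒<ᵇ)
open import Data.Fin using (Fin; zero; suc; toℕ; punchIn; punchOut; cast)
open import Data.Fin.Properties
  using (_≟_; toℕ-injective; suc-injective; cast-involutive;
         punchInᵢ≢i; punchIn-punchOut; punchOut-punchIn; punchOut-cong)
open import Data.Bool using (Bool; true; false; T; _∧_; _∨_; not)
open import Data.Bool.Properties using (∨-zeroʳ; ∨-assoc; ∨-comm; T-≡; T-∧)
open import Data.Sum using (_⊎_; inj₁; inj₂)
open import Data.List using (List; []; length; lookup; filterᵇ; tabulate; replicate; _++_; concatMap; allFin)
open import Data.List.Properties using (length-tabulate; lookup-tabulate)
import Data.List.Relation.Unary.All as All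
open import Data.List.Relation.Unary.Unique.Propositional using (Unique)
open import Data.List.Relation.Unary.AllPairs using (_∷_)
open import Data.List.Membership.Propositional using (_∈_)
open import Data.List.Membership.Propositional.Properties using (∈-lookup; ∈-allFin; ∈-filter⁺; ∈-filter⁻)
import Data.List.Relation.Unary.Any as Any
import Data.List.Relation.Unary.Any.Properties as AnyProp
open AnyProp using (any⁺; any⁻)
import Data.List.Relation.Unary.Unique.Propositional.Properties as Unique
import Data.List.Relation.Unary.All.Properties as AllProp
open AllProp using (all⁺; all⁻)
open import Data.Unit using (tt)
open import Data.Product using (∃-syntax; _×_; _,_; proj₁; proj₂)
open import Data.Maybe using (Maybe; just; nothing; maybe; Is-just)
open import Data.Maybe.Relation.Unary.Any using (just)
open import Relation.Nullary using (¬_; Dec; yes; no; contradiction; T?)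
open import Relation.Binary using (tri<; tri≈; tri>)
open import Relation.Binary.PropositionalEquality
  using (_≡_; _≢_; refl; sym; trans; cong; cong₂; subst; subst₂; module ≡-Reasoning)

beq⇒≡ : ∀ {x y} → T (beq x y) → x ≡ y
beq⇒≡ {true} {true} _ = refl
beq⇒≡ {false} {false} _ = refl

≡⇒beq : ∀ {x y} → x ≡ y → T (beq x y)
≡⇒beq {true} refl = tt
≡⇒beq {false} refl = tt

¬T-not : ∀ {x} → ¬ T (not x) → T x
¬T-not {true} _ = tt
¬T-not {false} ¬t = ¬t tt

T-not⇒¬T : ∀ {x} → T (not x) → ¬ T x
T-not⇒¬T {false} _ ()

feq-refl : ∀ {n} (a : Fin n) → feq a a ≡ true
feq-refl a with a ≟ a
... | yes _ = refl
... | no a≢a = contradiction refl a≢a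

feq-≢ : ∀ {n} {a b : Fin n} → a ≢ b → feq a b ≡ false
feq-≢ {a = a} {b} a≢b with a ≟ b
... | yes a≡b = contradiction a≡b a≢b
... | no _ = refl

feq⇒≡ : ∀ {n} {a b : Fin n} → feq a b ≡ true → a ≡ b
feq⇒≡ {a = a} {b} _ with a ≟ b
feq⇒≡ _ | yes a≡b = a≡b
feq⇒≡ () | no _

feq-injective : ∀ {n m} {h : Fin n → Fin m} → Injective _≡_ _≡_ h →
                ∀ a b → feq (h a) (h b) ≡ feq a b
feq-injective {h = h} h-inj a b with a ≟ b
... | yes refl = feq-refl (h a)
... | no a≢b = feq-≢ (a≢b ∘ h-inj)

bit : Bool → ℕ
bit true = 1
bit false = 0

count : ∀ {n} → (Fin n → Bool) → ℕ
count {zero} p = 0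
count {suc n} p = bit (p zero) + count (p ∘ suc)

count-cong : ∀ {n} {p q : Fin n → Bool} → (∀ i → p i ≡ q i) → count p ≡ count q
count-cong {zero} p≗q = refl
count-cong {suc n} p≗q = cong₂ _+_ (cong bit (p≗q zero)) (count-cong (p≗q ∘ suc))

count-none : ∀ {n} (p : Fin n → Bool) → (∀ i → p i ≡ false) → count p ≡ 0
count-none {zero} p none = refl
count-none {suc n} p none rewrite none zero = count-none (p ∘ suc) (none ∘ suc)

count-all : ∀ n → count {n} (λ _ → true) ≡ n
count-all zero = refl
count-all (suc n) = cong suc (count-all n)

count-witness : ∀ {n k} (p : Fin n → Bool) → count p ≡ suc k → ∃[ y ] p y ≡ true
count-witness {suc n} p c with p zero in p0
... | true = zero , p0
... | false = let (y , py) = count-witness (p ∘ suc) c in suc y , py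

count-punchIn : ∀ {n} (p : Fin (suc n) → Bool) (y : Fin (suc n)) →
                count p ≡ bit (p y) + count (p ∘ punchIn y)
count-punchIn p zero = refl
count-punchIn {suc n} p (suc y) rewrite count-punchIn (p ∘ suc) y with p zero | p (suc y)
... | true | true = refl
... | true | false = refl
... | false | _ = refl

length-filter-tabulate : ∀ {A : Set} {n} (p : A → Bool) (h : Fin n → A) →
                         length (filterᵇ p (tabulate h)) ≡ count (p ∘ h)
length-filter-tabulate {n = zero} p h = refl
length-filter-tabulate {n = suc n} p h with p (h zero)
... | true = cong suc (length-filter-tabulate p (h ∘ suc))
... | false = length-filter-tabulate p (h ∘ suc)

fibre : ∀ {n p} → (Fin n → Fin p) → Fin p → ℕ
fibre f c = count (λ i → feq (f i) c)

fibre-head : ∀ {n p} (f : Fin (suc n) → Fin p) → fibre f (f zero) ≡ suc (fibre (f ∘ suc) (f zero))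
fibre-head f rewrite feq-refl (f zero) = refl

record FibreIso {n N p : ℕ} (f : Fin n → Fin p) (g : Fin N → Fin p) : Set where
  field
    to      : Fin n → Fin N
    from    : Fin N → Fin n
    from-to : ∀ i → from (to i) ≡ i
    to-from : ∀ j → to (from j) ≡ j
    over    : ∀ i → g (to i) ≡ f i

  to-injective : Injective _≡_ _≡_ to
  to-injective {i} {i′} eq = trans (sym (from-to i)) (trans (cong from eq) (from-to i′))

fibreIso-cons : ∀ {n N p} {f : Fin (suc n) → Fin p} {g : Fin (suc N) → Fin p} (y : Fin (suc N)) →
                g y ≡ f zero → FibreIso (f ∘ suc) (g ∘ punchIn y) → FibreIso f g
fibreIso-cons {n} {N} {f = f} {g} y gy≡f0 β = record
  { to = to ; from = from ; from-to = from-to ; to-from = to-from ; over = over }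
  where
  module β = FibreIso β

  to : Fin (suc n) → Fin (suc N)
  to zero = y
  to (suc i) = punchIn y (β.to i)

  from′ : ∀ j → Dec (j ≡ y) → Fin (suc n)
  from′ j (yes _) = zero
  from′ j (no j≢y) = suc (β.from (punchOut (j≢y ∘ sym)))

  from : Fin (suc N) → Fin (suc n)
  from j = from′ j (j ≟ y)

  from-to : ∀ i → from (to i) ≡ i
  from-to zero with y ≟ y
  ... | yes _ = refl
  ... | no y≢y = contradiction refl y≢y
  from-to (suc i) with punchIn y (β.to i) ≟ y
  ... | yes eq = contradiction eq (punchInᵢ≢i y (β.to i))
  ... | no _ = cong suc (trans (cong β.from (trans (punchOut-cong y refl) (punchOut-punchIn y))) (β.from-to i))

  to-from : ∀ j → to (from j) ≡ j
  to-from j with j ≟ y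
  ... | yes j≡y = sym j≡y
  ... | no _ = trans (cong (punchIn y) (β.to-from _)) (punchIn-punchOut _)

  over : ∀ i → g (to i) ≡ f i
  over zero = gy≡f0
  over (suc i) = β.over i

fibre-iso : ∀ {p} n N (f : Fin n → Fin p) (g : Fin N → Fin p) →
            (∀ c → fibre f c ≡ fibre g c) → FibreIso f g
fibre-iso zero zero f g _ = record
  { to = λ () ; from = λ () ; from-to = λ () ; to-from = λ () ; over = λ () }
fibre-iso zero (suc N) f g same with trans (same (g zero)) (fibre-head g)
... | ()
fibre-iso (suc n) zero f g same with trans (sym (fibre-head f)) (same (f zero))
... | ()
fibre-iso (suc n) (suc N) f g same = fibreIso-cons y gy≡f0 (fibre-iso n N (f ∘ suc) (g ∘ punchIn y) same′)
  where
  y-in-fibre : ∃[ y ] feq (g y) (f zero) ≡ true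
  y-in-fibre = count-witness _ (trans (sym (same (f zero))) (fibre-head f))
  y = proj₁ y-in-fibre
  gy≡f0 : g y ≡ f zero
  gy≡f0 = feq⇒≡ (proj₂ y-in-fibre)
  same′ : ∀ c → fibre (f ∘ suc) c ≡ fibre (g ∘ punchIn y) c
  same′ c = +-cancelˡ-≡ (bit (feq (f zero) c)) _ _ (begin
    bit (feq (f zero) c) + fibre (f ∘ suc) c    ≡⟨ same c ⟩
    fibre g c                                    ≡⟨ count-punchIn (λ j → feq (g j) c) y ⟩
    bit (feq (g y) c) + fibre (g ∘ punchIn y) c  ≡⟨ cong (λ z → bit (feq z c) + fibre (g ∘ punchIn y) c) gy≡f0 ⟩
    bit (feq (f zero) c) + fibre (g ∘ punchIn y) c ∎)
    where open ≡-Reasoning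

unique-lookup-injective : ∀ {A : Set} {xs : List A} → Unique xs → Injective _≡_ _≡_ (lookup xs)
unique-lookup-injective (_ ∷ _) {zero} {zero} _ = refl
unique-lookup-injective (x∉xs ∷ _) {zero} {suc j} eq = contradiction eq (All.lookup x∉xs (∈-lookup j))
unique-lookup-injective (x∉xs ∷ _) {suc i} {zero} eq = contradiction (sym eq) (All.lookup x∉xs (∈-lookup i))
unique-lookup-injective (_ ∷ uniq) {suc i} {suc j} eq = cong suc (unique-lookup-injective uniq eq)

lookup-tabulate′ : ∀ {A : Set} {n} (f : Fin n → A) (i : Fin (length (tabulate f))) →
                   lookup (tabulate f) i ≡ f (cast (length-tabulate f) i)
lookup-tabulate′ f i = trans (cong (lookup (tabulate f)) (sym (cast-involutive (sym (length-tabulate f)) (length-tabulate f) i)))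
                             (lookup-tabulate f (cast (length-tabulate f) i))

cast-injective : ∀ {m n} .(eq : m ≡ n) → Injective _≡_ _≡_ (cast eq)
cast-injective eq {i} {j} ci≡cj = trans (sym (cast-involutive (sym eq) eq i))
                                        (trans (cong (cast (sym eq)) ci≡cj) (cast-involutive (sym eq) eq j))

expand : ∀ {A : Set} m → (Fin m → ℕ) → (Fin m → A) → List A
expand zero w x = []
expand (suc m) w x = replicate (w zero) (x zero) ++ expand m (w ∘ suc) (x ∘ suc)

expand-concatMap : ∀ {A : Set} {m} (w : Fin m → ℕ) (x : Fin m → A) →
                   concatMap (λ k → replicate (w k) (x k)) (allFin m) ≡ expand m w x
expand-concatMap {m = m} w x = go (λ k → k)
  where
  go : ∀ {l} (h : Fin l → Fin m) →
       concatMap (λ k → replicate (w k) (x k)) (tabulate h) ≡ expand l (w ∘ h) (x ∘ h)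
  go {zero} h = refl
  go {suc l} h = cong (replicate (w (h zero)) (x (h zero)) ++_) (go (h ∘ suc))

module _ {A : Set} where

  -- an index into  replicate a v ++ ys  is one of the copies of v or an index into ys
  block : ∀ a (v : A) ys → Fin (length (replicate a v ++ ys)) → Maybe (Fin (length ys))
  block zero v ys e = just e
  block (suc a) v ys zero = nothing
  block (suc a) v ys (suc e) = block a v ys e

  lookup-block-nothing : ∀ a (v : A) ys e → block a v ys e ≡ nothing → lookup (replicate a v ++ ys) e ≡ v
  lookup-block-nothing (suc a) v ys zero _ = refl
  lookup-block-nothing (suc a) v ys (suc e) b = lookup-block-nothing a v ys e b

  lookup-block-just : ∀ a (v : A) ys e e′ → block a v ys e ≡ just e′ → lookup (replicate a v ++ ys) e ≡ lookup ys e′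
  lookup-block-just zero v ys e .e refl = refl
  lookup-block-just (suc a) v ys (suc e) e′ b = lookup-block-just a v ys e e′ b

  count-block : ∀ a (v : A) ys (q : Maybe (Fin (length ys)) → Bool) →
                count (q ∘ block a v ys) ≡ count {a} (λ _ → q nothing) + count (q ∘ just)
  count-block zero v ys q = refl
  count-block (suc a) v ys q rewrite count-block a v ys q with q nothing
  ... | true = refl
  ... | false = refl

  source : ∀ m w (x : Fin m → A) → Fin (length (expand m w x)) → Fin m
  source (suc m) w x = maybe (suc ∘ source m (w ∘ suc) (x ∘ suc)) zero ∘ block (w zero) (x zero) _

  lookup-source : ∀ m w (x : Fin m → A) e → lookup (expand m w x) e ≡ x (source m w x e)
  lookup-source (suc m) w x e with block (w zero) (x zero) (expand m (w ∘ suc) (x ∘ suc)) e in b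
  ... | nothing = lookup-block-nothing (w zero) (x zero) _ e b
  ... | just e′ = trans (lookup-block-just (w zero) (x zero) _ e e′ b) (lookup-source m (w ∘ suc) (x ∘ suc) e′)

  fibre-source : ∀ m w (x : Fin m → A) k → fibre (source m w x) k ≡ w k
  fibre-source (suc m) w x k =
    trans (count-block (w zero) (x zero) _ (λ s → feq (maybe (suc ∘ source′) zero s) k)) (split k)
    where
    source′ = source m (w ∘ suc) (x ∘ suc)
    split : ∀ k → count {w zero} (λ _ → feq zero k) + count (λ e′ → feq (suc (source′ e′)) k) ≡ w k
    split zero = begin
      count {w zero} (λ _ → true) + count (λ e′ → feq (suc (source′ e′)) zero)
        ≡⟨ cong₂ _+_ (count-all (w zero)) (count-none (λ e′ → feq (suc (source′ e′)) zero) (λ _ → refl)) ⟩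
      w zero + 0
        ≡⟨ +-identityʳ (w zero) ⟩
      w zero ∎
      where open ≡-Reasoning
    split (suc k) = begin
      count {w zero} (λ _ → false) + count (λ e′ → feq (suc (source′ e′)) (suc k))
        ≡⟨ cong₂ _+_ (count-none {w zero} (λ _ → false) (λ _ → refl))
                     (count-cong (λ e′ → feq-injective suc-injective (source′ e′) k)) ⟩
      fibre source′ k
        ≡⟨ fibre-source m (w ∘ suc) (x ∘ suc) k ⟩
      w (suc k) ∎
      where open ≡-Reasoning

shareEnd : ∀ {n} → Fin n × Fin n → Fin n × Fin n → Bool
shareEnd (a , b) (c , d) = feq a c ∨ feq a d ∨ feq b c ∨ feq b d

Parallel : ∀ {n} → Fin n × Fin n → Fin n × Fin n → Set
Parallel p q = (proj₁ p ≡ proj₁ q × proj₂ p ≡ proj₂ q) ⊎ (proj₁ p ≡ proj₂ q × proj₂ p ≡ proj₁ q)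

shareEnd-refl : ∀ {n} (p : Fin n × Fin n) → shareEnd p p ≡ true
shareEnd-refl (a , b) rewrite feq-refl a = refl

parallel-sym : ∀ {n} {p q : Fin n × Fin n} → Parallel p q → Parallel q p
parallel-sym (inj₁ (eq₁ , eq₂)) = inj₁ (sym eq₁ , sym eq₂)
parallel-sym (inj₂ (eq₁ , eq₂)) = inj₂ (sym eq₂ , sym eq₁)

parallel-shareEnd : ∀ {n} {p q : Fin n × Fin n} → Parallel p q → shareEnd p q ≡ true
parallel-shareEnd {p = a , b} (inj₁ (refl , refl)) = shareEnd-refl (a , b)
parallel-shareEnd {p = a , b} (inj₂ (refl , refl)) rewrite feq-refl a = ∨-zeroʳ (feq a b)

∨-swap : ∀ w x y z → w ∨ x ∨ y ∨ z ≡ y ∨ z ∨ w ∨ x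
∨-swap w x y z = begin
  w ∨ (x ∨ (y ∨ z))  ≡⟨ sym (∨-assoc w x (y ∨ z)) ⟩
  (w ∨ x) ∨ (y ∨ z)  ≡⟨ ∨-comm (w ∨ x) (y ∨ z) ⟩
  (y ∨ z) ∨ (w ∨ x)  ≡⟨ ∨-assoc y z (w ∨ x) ⟩
  y ∨ (z ∨ (w ∨ x))  ∎
  where open ≡-Reasoning

parallel-shareEnd-cong : ∀ {n} {p q : Fin n × Fin n} → Parallel p q → ∀ r → shareEnd p r ≡ shareEnd q r
parallel-shareEnd-cong (inj₁ (refl , refl)) r = refl
parallel-shareEnd-cong {p = a , b} (inj₂ (refl , refl)) (c , d) = ∨-swap (feq a c) (feq a d) (feq b c) (feq b d)

distinct-adj : ∀ M {u v : Edge M} → u ≢ v → Graph.adj (L M) u v ≡ shareEnd (ends M u) (ends M v)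
distinct-adj M u≢v rewrite feq-≢ u≢v = refl

module _ (M : Multigraph) {u v : Edge M} (u≢v : u ≢ v) (u∥v : Parallel (ends M u) (ends M v)) where

  parallel-adjacent : Graph.adj (L M) u v ≡ true
  parallel-adjacent = trans (distinct-adj M u≢v) (parallel-shareEnd u∥v)

  parallel-closedNb : ∀ w → inClosedNb (L M) u w ≡ inClosedNb (L M) v w
  parallel-closedNb w = by-cases (w ≟ u) (w ≟ v)
    where
    by-cases : Dec (w ≡ u) → Dec (w ≡ v) → inClosedNb (L M) u w ≡ inClosedNb (L M) v w
    by-cases (yes refl) _ rewrite feq-refl w | feq-≢ u≢v | feq-≢ (u≢v ∘ sym)
      | parallel-shareEnd (parallel-sym u∥v) = refl
    by-cases (no _) (yes refl) rewrite feq-refl w | feq-≢ u≢v | feq-≢ (u≢v ∘ sym)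
      | parallel-shareEnd u∥v = refl
    by-cases (no w≢u) (no w≢v) rewrite feq-≢ w≢u | feq-≢ w≢v | feq-≢ (w≢u ∘ sym) | feq-≢ (w≢v ∘ sym)
      = parallel-shareEnd-cong u∥v (ends M w)

module _ {G H : Graph} (φ : Iso G H) where
  open Iso φ

  iso-to-injective : Injective _≡_ _≡_ to
  iso-to-injective {a} {b} eq = trans (sym (from-to a)) (trans (cong from eq) (from-to b))

  iso-from-injective : Injective _≡_ _≡_ from
  iso-from-injective {a} {b} eq = trans (sym (to-from a)) (trans (cong to eq) (to-from b))

  iso-closedNb : ∀ a k → inClosedNb G a k ≡ inClosedNb H (to a) (to k)
  iso-closedNb a k = cong₂ _∨_ (sym (feq-injective iso-to-injective k a)) (sym (preserve a k))

module TrueTwins (G : Graph) (simple : IsSimple G) where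
  open Graph G

  adj-sym : ∀ i j → adj i j ≡ adj j i
  adj-sym = proj₁ simple

  adj-irrefl : ∀ i → adj i i ≡ false
  adj-irrefl = proj₂ simple

  SameClosedNb : Fin size → Fin size → Set
  SameClosedNb a b = ∀ k → inClosedNb G a k ≡ inClosedNb G b k

  Twin : Fin size → Fin size → Set
  Twin a b = T (twinOrEq G a b)

  twin-cases : ∀ a b → Twin a b → a ≡ b ⊎ (adj a b ≡ true × SameClosedNb a b)
  twin-cases a b t with a ≟ b
  ... | yes a≡b = inj₁ a≡b
  ... | no _ = inj₂ (Equivalence.to T-≡ ab , λ k → beq⇒≡ (All.lookup (all⁺ _ _ nb) (∈-allFin k)))
    where
    ab = proj₁ (Equivalence.to T-∧ t)
    nb = proj₂ (Equivalence.to T-∧ t)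

  twin-intro : ∀ a b → adj a b ≡ true → SameClosedNb a b → Twin a b
  twin-intro a b ab nb with a ≟ b
  ... | yes _ = tt
  ... | no _ rewrite ab = all⁻ _ (AllProp.tabulate⁺ (λ k → ≡⇒beq (nb k)))

  twin-refl : ∀ a → Twin a a
  twin-refl a rewrite feq-refl a = tt

  twin-closedNb : ∀ {a b} → Twin a b → SameClosedNb a b
  twin-closedNb {a} {b} t with twin-cases a b t
  ... | inj₁ refl = λ _ → refl
  ... | inj₂ (_ , nb) = nb

  twin-sym : ∀ {a b} → Twin a b → Twin b a
  twin-sym {a} {b} t with twin-cases a b t
  ... | inj₁ refl = twin-refl a
  ... | inj₂ (ab , nb) = twin-intro b a (trans (adj-sym b a) ab) (sym ∘ nb)

  twin-trans : ∀ {a b c} → Twin a b → Twin b c → Twin a c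
  twin-trans {a} {b} {c} t u with twin-cases a b t | twin-cases b c u
  ... | inj₁ refl | _ = u
  ... | _ | inj₁ refl = t
  ... | inj₂ (_ , nab) | inj₂ (bc , nbc) = by-cases (a ≟ c)
    where
    c∈N[b] : inClosedNb G b c ≡ true
    c∈N[b] rewrite bc = ∨-zeroʳ (feq c b)
    by-cases : Dec (a ≡ c) → Twin a c
    by-cases (yes refl) = twin-refl a
    by-cases (no a≢c) = twin-intro a c ac (λ k → trans (nab k) (nbc k))
      where
      ac : adj a c ≡ true
      ac with trans (nab c) c∈N[b]
      ... | c∈N[a] rewrite feq-≢ (a≢c ∘ sym) = c∈N[a]

  twin-adj-other : ∀ {a b} → Twin a b → ∀ k → k ≢ a → k ≢ b → adj a k ≡ adj b k
  twin-adj-other t k k≢a k≢b with twin-closedNb t k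
  ... | eq rewrite feq-≢ k≢a | feq-≢ k≢b = eq

  twin-adj : ∀ {a i b j} → Twin a i → Twin b j → ¬ Twin i j → adj a b ≡ adj i j
  twin-adj {a} {i} {b} {j} ta tb ¬tij = begin
    adj a b  ≡⟨ twin-adj-other ta b b≢a b≢i ⟩
    adj i b  ≡⟨ adj-sym i b ⟩
    adj b i  ≡⟨ twin-adj-other tb i (b≢i ∘ sym) i≢j ⟩
    adj j i  ≡⟨ adj-sym j i ⟩
    adj i j  ∎
    where
    open ≡-Reasoning
    b≢a : b ≢ a
    b≢a refl = ¬tij (twin-trans (twin-sym ta) tb)
    b≢i : b ≢ i
    b≢i refl = ¬tij tb
    i≢j : i ≢ j
    i≢j refl = ¬tij (twin-refl i)

  Rep : Fin size → Set
  Rep i = T (isRep G i)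

  rep : Fin (length (reps G)) → Fin size
  rep = lookup (reps G)

  rep-isRep : ∀ c → Rep (rep c)
  rep-isRep c = proj₂ (∈-filter⁻ (T? ∘ isRep G) {xs = allFin size} (∈-lookup c))

  rep-injective : Injective _≡_ _≡_ rep
  rep-injective = unique-lookup-injective (Unique.filter⁺ (T? ∘ isRep G) (Unique.allFin⁺ size))

  smaller-twin : ∀ i → ¬ Rep i → ∃[ j ] toℕ j < toℕ i × Twin j i
  smaller-twin i ¬rep with AnyProp.tabulate⁻ (any⁻ _ (allFin size) (¬T-not ¬rep))
  ... | j , j<i∧twin = j , <ᵇ⇒< (toℕ j) (toℕ i) (proj₁ pair) , proj₂ pair
    where pair = Equivalence.to T-∧ j<i∧twin

  no-smaller-twin : ∀ {a b} → Twin a b → toℕ a < toℕ b → ¬ Rep b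
  no-smaller-twin {a} {b} t a<b rep-b =
    T-not⇒¬T rep-b (any⁺ _ (AnyProp.tabulate⁺ a (Equivalence.from T-∧ (<⇒<ᵇ a<b , t))))

  rep-unique : ∀ {a b} → Rep a → Rep b → Twin a b → a ≡ b
  rep-unique {a} {b} rep-a rep-b t with <-cmp (toℕ a) (toℕ b)
  ... | tri< a<b _ _ = contradiction rep-b (no-smaller-twin t a<b)
  ... | tri≈ _ a≡b _ = toℕ-injective a≡b
  ... | tri> _ _ b<a = contradiction rep-a (no-smaller-twin (twin-sym t) b<a)

  rep-exists : ∀ i → ∃[ r ] Rep r × Twin r i
  rep-exists i = below (suc (toℕ i)) i (n<1+n (toℕ i))
    where
    below : ∀ bound i → toℕ i < bound → ∃[ r ] Rep r × Twin r i
    below (suc bound) i (s≤s i<bound) with T? (isRep G i)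
    ... | yes rep-i = i , rep-i , twin-refl i
    ... | no ¬rep-i with smaller-twin i ¬rep-i
    ... | j , j<i , tji with below bound j (<-≤-trans j<i i<bound)
    ... | r , rep-r , trj = r , rep-r , twin-trans trj tji

  class-membership : ∀ i → proj₁ (rep-exists i) ∈ reps G
  class-membership i = ∈-filter⁺ (T? ∘ isRep G) (∈-allFin _) (proj₁ (proj₂ (rep-exists i)))

  class : Fin size → Fin (length (reps G))
  class i = Any.index (class-membership i)

  twin-rep-class : ∀ i → Twin (rep (class i)) i
  twin-rep-class i rewrite sym (AnyProp.lookup-index (class-membership i)) = proj₂ (proj₂ (rep-exists i))

  class-feq : ∀ i c → feq (class i) c ≡ twinOrEq G (rep c) i
  class-feq i c with class i ≟ c
  ... | yes refl = sym (Equivalence.to T-≡ (twin-rep-class i))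
  ... | no ci≢c with twinOrEq G (rep c) i in eq
  ... | true = contradiction (rep-injective (rep-unique (rep-isRep _) (rep-isRep c) rep-twins)) ci≢c
    where rep-twins = twin-trans (twin-rep-class i) (twin-sym (Equivalence.from T-≡ eq))
  ... | false = refl

  same-class : ∀ {i j} → class i ≡ class j → Twin i j
  same-class {i} {j} ci≡cj =
    twin-trans (twin-sym (twin-rep-class i)) (subst (λ c → Twin (rep c) j) (sym ci≡cj) (twin-rep-class j))

  different-class : ∀ {i j} → class i ≢ class j → ¬ Twin i j
  different-class {i} {j} ci≢cj t =
    ci≢cj (sym (feq⇒≡ (trans (class-feq j (class i)) (Equivalence.to T-≡ (twin-trans (twin-rep-class i) t)))))

  class-size : ∀ c → fibre class c ≡ label G c
  class-size c = trans (count-cong (λ i → class-feq i c))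
                       (sym (length-filter-tabulate (twinOrEq G (rep c)) (λ k → k)))

  class-adjacency : ∀ {i j} → class i ≢ class j → adj (rep (class i)) (rep (class j)) ≡ adj i j
  class-adjacency ci≢cj = twin-adj (twin-rep-class _) (twin-rep-class _) (different-class ci≢cj)

-- Direction (⇒).  If G ≅ L(G') with G' loopless, then choosing one edge of G'
-- per twin class yields a simple graph H' with L(H') ≅ contract G.
module LineMultigraph⇒LehotOutput (G : Graph) (simple : IsSimple G)
         (G' : Multigraph) (G'-loopless : Loopless G') (φ : Iso G (L G')) where
  open TrueTwins G simple
  module φ = Iso φ

  parallel⇒twin : ∀ {a b} → φ.to a ≢ φ.to b → Parallel (ends G' (φ.to a)) (ends G' (φ.to b)) → Twin a b
  parallel⇒twin {a} {b} ne par = twin-intro a b adj-ab same-nb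
    where
    adj-ab : Graph.adj G a b ≡ true
    adj-ab = trans (sym (φ.preserve a b)) (parallel-adjacent G' ne par)
    same-nb : SameClosedNb a b
    same-nb k = begin
      inClosedNb G a k                 ≡⟨ iso-closedNb φ a k ⟩
      inClosedNb (L G') (φ.to a) (φ.to k) ≡⟨ parallel-closedNb G' ne par (φ.to k) ⟩
      inClosedNb (L G') (φ.to b) (φ.to k) ≡⟨ sym (iso-closedNb φ b k) ⟩
      inClosedNb G b k                 ∎
      where open ≡-Reasoning

  edgeOf : Fin (length (reps G)) → Edge G'
  edgeOf c = φ.to (rep c)

  edgeOf-injective : Injective _≡_ _≡_ edgeOf
  edgeOf-injective = rep-injective ∘ iso-to-injective φ

  edgeOf-not-parallel : ∀ c d → Parallel (ends G' (edgeOf c)) (ends G' (edgeOf d)) → c ≡ d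
  edgeOf-not-parallel c d par with c ≟ d
  ... | yes c≡d = c≡d
  ... | no c≢d = contradiction (rep-injective (rep-unique (rep-isRep c) (rep-isRep d) twins)) c≢d
    where twins = parallel⇒twin (c≢d ∘ edgeOf-injective) par

  H' : Multigraph
  H' = record { nv = Multigraph.nv G' ; edges = tabulate (ends G' ∘ edgeOf) }

  #edges-H' : length (Multigraph.edges H') ≡ length (reps G)
  #edges-H' = length-tabulate (ends G' ∘ edgeOf)

  classOf : Edge H' → Fin (length (reps G))
  classOf = cast #edges-H'

  classOf-injective : Injective _≡_ _≡_ classOf
  classOf-injective = cast-injective #edges-H'

  ends-H' : ∀ k → ends H' k ≡ ends G' (edgeOf (classOf k))
  ends-H' = lookup-tabulate′ (ends G' ∘ edgeOf)

  H'-simple : IsSimpleMG H'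
  H'-simple = AllProp.tabulate⁺ (λ c → All.lookup G'-loopless (∈-lookup (edgeOf c)))
            , λ k l par → classOf-injective (edgeOf-not-parallel _ _ (subst₂ Parallel (ends-H' k) (ends-H' l) par))

  H'-line : Iso (L H') (contract G)
  H'-line = record
    { to = classOf
    ; from = cast (sym #edges-H')
    ; from-to = cast-involutive (sym #edges-H') #edges-H'
    ; to-from = cast-involutive #edges-H' (sym #edges-H')
    ; preserve = preserve
    }
    where
    preserve : ∀ k l → Graph.adj (contract G) (classOf k) (classOf l) ≡ Graph.adj (L H') k l
    preserve k l = begin
      Graph.adj G (rep (classOf k)) (rep (classOf l))
        ≡⟨ sym (φ.preserve _ _) ⟩
      not (feq (edgeOf (classOf k)) (edgeOf (classOf l)))
        ∧ shareEnd (ends G' (edgeOf (classOf k))) (ends G' (edgeOf (classOf l)))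
        ≡⟨ cong₂ (λ u v → not u ∧ v) (feq-injective (classOf-injective ∘ edgeOf-injective) k l)
                                     (sym (cong₂ shareEnd (ends-H' k) (ends-H' l))) ⟩
      not (feq k l) ∧ shareEnd (ends H' k) (ends H' l)
        ∎
      where open ≡-Reasoning

  lehot-output : LehotOutput (contract G)
  lehot-output = H' , H'-simple , H'-line

module LehotOutput⇒LineMultigraph (G : Graph) (simple : IsSimple G) (out : LehotOutput (contract G)) where
  open TrueTwins G simple
  open Graph G using (size)

  H' : Multigraph
  H' = proj₁ out

  H'-loopless : Loopless H'
  H'-loopless = proj₁ (proj₁ (proj₂ out))

  ψ : Iso (L H') (contract G)
  ψ = proj₂ (proj₂ out)
  module ψ = Iso ψ

  m : ℕ
  m = length (Multigraph.edges H')

  multiplicity : Edge H' → ℕ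
  multiplicity k = label G (ψ.to k)

  G'-edges : List (Fin (Multigraph.nv H') × Fin (Multigraph.nv H'))
  G'-edges = expand m multiplicity (ends H')

  G'-edges-step3 : Multigraph.edges (step3 G out) ≡ G'-edges
  G'-edges-step3 = expand-concatMap multiplicity (ends H')

  step3-loopless : Loopless (step3 G out)
  step3-loopless = AllProp.concat⁺ (AllProp.map⁺ (AllProp.tabulate⁺ λ k →
                     AllProp.replicate⁺ (multiplicity k) (All.lookup H'-loopless (∈-lookup k))))

  edgeOfClass : Fin size → Edge H'
  edgeOfClass i = ψ.from (class i)

  edgeOfClass-fibres : ∀ k → fibre edgeOfClass k ≡ fibre (source m multiplicity (ends H')) k
  edgeOfClass-fibres k = begin
    count (λ i → feq (ψ.from (class i)) k)   ≡⟨ count-cong (λ i → feq-from (class i)) ⟩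
    fibre class (ψ.to k)                     ≡⟨ class-size (ψ.to k) ⟩
    multiplicity k                           ≡⟨ sym (fibre-source m multiplicity (ends H') k) ⟩
    fibre (source m multiplicity (ends H')) k ∎
    where
    open ≡-Reasoning
    feq-from : ∀ c → feq (ψ.from c) k ≡ feq c (ψ.to k)
    feq-from c = trans (cong (feq (ψ.from c)) (sym (ψ.from-to k))) (feq-injective (iso-from-injective ψ) c (ψ.to k))

  -- adjacency of the edges assigned to i and j, with copies distinguished by i ≟ j,
  -- is adjacency in G: same class gives twins, distinct classes go through H
  blowup-adj : ∀ i j → not (feq i j) ∧ shareEnd (ends H' (edgeOfClass i)) (ends H' (edgeOfClass j)) ≡ Graph.adj G i j
  blowup-adj i j = by-cases (class i ≟ class j) (i ≟ j)
    where
    by-cases : Dec (class i ≡ class j) → Dec (i ≡ j) →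
               not (feq i j) ∧ shareEnd (ends H' (edgeOfClass i)) (ends H' (edgeOfClass j)) ≡ Graph.adj G i j
    by-cases _ (yes refl) rewrite feq-refl i = sym (adj-irrefl i)
    by-cases (yes ci≡cj) (no i≢j) with twin-cases i j (same-class ci≡cj)
    ... | inj₁ i≡j = contradiction i≡j i≢j
    ... | inj₂ (adj-ij , _) rewrite feq-≢ i≢j | ci≡cj | shareEnd-refl (ends H' (edgeOfClass j)) = sym adj-ij
    by-cases (no ci≢cj) (no i≢j) rewrite feq-≢ i≢j = begin
      shareEnd (ends H' (edgeOfClass i)) (ends H' (edgeOfClass j))
        ≡⟨ sym (distinct-adj H' (ci≢cj ∘ iso-from-injective ψ)) ⟩
      Graph.adj (L H') (ψ.from (class i)) (ψ.from (class j))
        ≡⟨ sym (ψ.preserve _ _) ⟩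
      Graph.adj (contract G) (ψ.to (ψ.from (class i))) (ψ.to (ψ.from (class j)))
        ≡⟨ cong₂ (Graph.adj (contract G)) (ψ.to-from _) (ψ.to-from _) ⟩
      Graph.adj G (rep (class i)) (rep (class j))
        ≡⟨ class-adjacency ci≢cj ⟩
      Graph.adj G i j ∎
      where open ≡-Reasoning

  G-line-expanded : Iso G (L (record { nv = Multigraph.nv H' ; edges = G'-edges }))
  G-line-expanded = record
    { to = β.to ; from = β.from ; from-to = β.from-to ; to-from = β.to-from ; preserve = preserve }
    where
    β = fibre-iso size _ edgeOfClass (source m multiplicity (ends H')) edgeOfClass-fibres
    module β = FibreIso β
    ends-β : ∀ i → lookup G'-edges (β.to i) ≡ ends H' (edgeOfClass i)
    ends-β i = trans (lookup-source m multiplicity (ends H') (β.to i)) (cong (ends H') (β.over i))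
    preserve : ∀ i j → not (feq (β.to i) (β.to j)) ∧ shareEnd (lookup G'-edges (β.to i)) (lookup G'-edges (β.to j))
                       ≡ Graph.adj G i j
    preserve i j = trans (cong₂ (λ u v → not u ∧ v) (feq-injective β.to-injective i j)
                                                   (cong₂ shareEnd (ends-β i) (ends-β j)))
                         (blowup-adj i j)

  step3-line : Iso G (L (step3 G out))
  step3-line = subst (λ es → Iso G (L (record { nv = Multigraph.nv H' ; edges = es })))
                     (sym G'-edges-step3) G-line-expanded

corollary2 : (lehot : LehotAlgorithm) → LehotSpec lehot →
    (G : Graph) → IsSimple G →
    (IsLineMultigraph G → Is-just (eLehot lehot G)) × (Is-just (eLehot lehot G) → IsLineMultigraph G)
corollary2 lehot lehot-spec G simple = line⇒output , output⇒line
  where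
  line⇒output : IsLineMultigraph G → Is-just (eLehot lehot G)
  line⇒output (G' , G'-loopless , φ) with lehot (contract G) in run
  ... | just _ = just tt
  ... | nothing = contradiction (LineMultigraph⇒LehotOutput.lehot-output G simple G' G'-loopless φ) (lehot-spec _ run)

  output⇒line : Is-just (eLehot lehot G) → IsLineMultigraph G
  output⇒line _ with lehot (contract G)
  output⇒line (just _) | just out = step3 G out , step3-loopless , step3-line
    where open LehotOutput⇒LineMultigraph G simple out
  output⇒line () | nothing
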